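{- If a finite simple graph $G$ has no triangle and no induced $C_4$, then $L_G=L(G)$.
   Context: A biclique of $G$ is a vertex set $B\subseteq V(G)$ such that $G[B]$ is a complete bipartite graph and $B$ is inclusion-wise maximal with this property. The biclique line graph $L_G$ has vertex set $E(G)$, two edges of $G$ being adjacent iff they are both edges of $G[B]$ for some biclique $B$ of $G$. $L(G)$ is the ordinary line graph of $G$ (vertex set $E(G)$, two edges adjacent iff they share an endpoint). $C_4$ is the cycle on four vertices. -}

module Defs where

open import Data.Nat using (ℕ)
open import Data.Fin using (Fin)
open import Data.Bool using (Bool; true; false; T)
open import Data.Fin.Subset using (Subset; _∈_; _∉_; _⊆_)
open import Data.Product using (Σ; ∃; ∃-syntax; _×_; _,_)
open import Data.Sum using (_⊎_)
open import Relation.Nullary using (¬_)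
open import Relation.Binary.PropositionalEquality using (_≡_; _≢_)

record Graph (n : ℕ) : Set where
  field
    adj   : Fin n → Fin n → Bool
    sym   : ∀ u v → adj u v ≡ adj v u
    irrefl : ∀ u → adj u u ≡ false

module _ {n : ℕ} (G : Graph n) where
  open Graph G

  Adj : Fin n → Fin n → Set
  Adj u v = T (adj u v)

  TriangleFree : Set
  TriangleFree = ∀ a b c → ¬ (Adj a b × Adj b c × Adj a c)

  InducedC4Free : Set
  InducedC4Free = ∀ a b c d → a ≢ c → b ≢ d →
    ¬ (Adj a b × Adj b c × Adj c d × Adj d a × ¬ Adj a c × ¬ Adj b d)

  InducesCompleteBipartite : Subset n → Set
  InducesCompleteBipartite B = Σ (Subset n) λ X → Σ (Subset n) λ Y →
      (∀ v → v ∈ B → (v ∈ X ⊎ v ∈ Y))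
    × (∀ v → v ∈ X → v ∈ B)
    × (∀ v → v ∈ Y → v ∈ B)
    × (∀ v → v ∈ X → v ∉ Y)
    × (∃[ x ] x ∈ X)
    × (∃[ y ] y ∈ Y)
    × (∀ x y → x ∈ X → y ∈ Y → Adj x y)
    × (∀ x x' → x ∈ X → x' ∈ X → ¬ Adj x x')
    × (∀ y y' → y ∈ Y → y' ∈ Y → ¬ Adj y y')

  IsBiclique : Subset n → Set
  IsBiclique B = InducesCompleteBipartite B
    × (∀ B' → B ⊆ B' → InducesCompleteBipartite B' → B' ⊆ B)

  -- Edges of G (an edge {u,v} is represented by an ordered pair; the pairs
  -- (u,v) and (v,u) denote the same edge).
  record Edge : Set where
    constructor edge
    field
      u v : Fin n
      uv  : Adj u v

  open Edge

  SameEdge : Edge → Edge → Set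
  SameEdge e f = (u e ≡ u f × v e ≡ v f) ⊎ (u e ≡ v f × v e ≡ u f)

  EdgeIn : Edge → Subset n → Set
  EdgeIn e B = u e ∈ B × v e ∈ B

  BicliqueLineAdj : Edge → Edge → Set
  BicliqueLineAdj e f = ¬ SameEdge e f ×
    (Σ (Subset n) λ B → IsBiclique B × EdgeIn e B × EdgeIn f B)

  LineAdj : Edge → Edge → Set
  LineAdj e f = ¬ SameEdge e f ×
    (u e ≡ u f ⊎ u e ≡ v f ⊎ v e ≡ u f ⊎ v e ≡ v f)

-- A complete bipartite induced subgraph of an induced-C4-free graph is a star:
-- two vertices on each side would span an induced C4.  Hence two edges of a
-- common biclique share an endpoint.  Conversely, if two edges meet at c, the
-- closed star {c} ∪ N(c) contains both; it is complete bipartite because G is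
-- triangle-free, and maximal because, being a star on at least two leaves,
-- any complete bipartite superset must keep c alone on its side.
module Submission where

open import Defs
open import Data.Nat using (ℕ)
open import Data.Bool using (T)
open import Data.Bool.Properties using (T-≡)
open import Data.Product using (_×_; _,_; ∃-syntax)
open import Data.Sum using (_⊎_; inj₁; inj₂; swap)
open import Data.Empty using (⊥-elim)
open import Data.Fin using (Fin; _≟_)
open import Data.Fin.Subset using (Subset; _∈_; _⊆_; ⁅_⁆; _∪_)
open import Data.Fin.Subset.Properties using (x∈⁅x⁆; x∈⁅y⁆⇒x≡y; x∈p∪q⁺; x∈p∪q⁻; p⊆p∪q; q⊆p∪q)
open import Data.Vec using (tabulate)
open import Data.Vec.Properties using (lookup∘tabulate; []=⇒lookup; lookup⇒[]=)
open import Function using (_∘_)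
open import Function.Bundles using (Equivalence)
open import Relation.Nullary using (¬_; yes; no)
open import Relation.Binary.PropositionalEquality using (_≡_; _≢_; refl; sym; trans; subst; subst₂)

module _ {n : ℕ} (G : Graph n) where
  open Graph G using (adj; irrefl)
  open Edge

  private variable
    a b c w x₁ x₂ y₁ y₂ : Fin n
    B S T′ : Subset n

  Adj-sym : Adj G a b → Adj G b a
  Adj-sym {a} {b} = subst T (Graph.sym G a b)

  Adj-irrefl : ¬ Adj G a a
  Adj-irrefl {a} = subst T (irrefl a)

  Independent : Subset n → Set
  Independent S = ∀ x x′ → x ∈ S → x′ ∈ S → ¬ Adj G x x′

  FullyJoined : Subset n → Subset n → Set
  FullyJoined S T′ = ∀ s t → s ∈ S → t ∈ T′ → Adj G s t

  FullyJoined-sym : FullyJoined S T′ → FullyJoined T′ S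
  FullyJoined-sym join t s t∈T′ s∈S = Adj-sym (join s t s∈S t∈T′)

  inducedC4Free⇒completeBipartite-star : InducedC4Free G →
    Independent S → Independent T′ → FullyJoined S T′ →
    x₁ ∈ S → x₂ ∈ S → y₁ ∈ T′ → y₂ ∈ T′ → x₁ ≡ x₂ ⊎ y₁ ≡ y₂
  inducedC4Free⇒completeBipartite-star {x₁ = x₁} {x₂} {y₁} {y₂}
    c4 indS indT join x₁∈S x₂∈S y₁∈T y₂∈T with x₁ ≟ x₂ | y₁ ≟ y₂
  ... | yes x₁≡x₂ | _ = inj₁ x₁≡x₂
  ... | no _ | yes y₁≡y₂ = inj₂ y₁≡y₂
  ... | no x₁≢x₂ | no y₁≢y₂ = ⊥-elim (c4 x₁ y₁ x₂ y₂ x₁≢x₂ y₁≢y₂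
          ( join x₁ y₁ x₁∈S y₁∈T , Adj-sym (join x₂ y₁ x₂∈S y₁∈T)
          , join x₂ y₂ x₂∈S y₂∈T , Adj-sym (join x₁ y₂ x₁∈S y₂∈T)
          , indS x₁ x₂ x₁∈S x₂∈S , indT y₁ y₂ y₁∈T y₂∈T ))

  Incident : Fin n → Edge G → Set
  Incident c e = u e ≡ c ⊎ v e ≡ c

  Meets : Edge G → Edge G → Set
  Meets e f = u e ≡ u f ⊎ u e ≡ v f ⊎ v e ≡ u f ⊎ v e ≡ v f

  incident⇒meets : ∀ e f → Incident c e → Incident c f → Meets e f
  incident⇒meets _ _ (inj₁ ue≡c) (inj₁ uf≡c) = inj₁ (trans ue≡c (sym uf≡c))
  incident⇒meets _ _ (inj₁ ue≡c) (inj₂ vf≡c) = inj₂ (inj₁ (trans ue≡c (sym vf≡c)))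
  incident⇒meets _ _ (inj₂ ve≡c) (inj₁ uf≡c) = inj₂ (inj₂ (inj₁ (trans ve≡c (sym uf≡c))))
  incident⇒meets _ _ (inj₂ ve≡c) (inj₂ vf≡c) = inj₂ (inj₂ (inj₂ (trans ve≡c (sym vf≡c))))

  edge-across : Independent S → Independent T′ →
    (∀ w → w ∈ B → w ∈ S ⊎ w ∈ T′) → ∀ e → EdgeIn G e B →
    ∃[ s ] ∃[ t ] s ∈ S × t ∈ T′ × Incident s e × Incident t e
  edge-across indS indT cover e (ue∈B , ve∈B) with cover _ ue∈B | cover _ ve∈B
  ... | inj₁ ue∈S | inj₁ ve∈S = ⊥-elim (indS _ _ ue∈S ve∈S (uv e))
  ... | inj₁ ue∈S | inj₂ ve∈T = u e , v e , ue∈S , ve∈T , inj₁ refl , inj₂ refl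
  ... | inj₂ ue∈T | inj₁ ve∈S = v e , u e , ve∈S , ue∈T , inj₂ refl , inj₁ refl
  ... | inj₂ ue∈T | inj₂ ve∈T = ⊥-elim (indT _ _ ue∈T ve∈T (uv e))

  completeBipartite-edges-meet : InducedC4Free G → InducesCompleteBipartite G B →
    ∀ e f → EdgeIn G e B → EdgeIn G f B → Meets e f
  completeBipartite-edges-meet c4 (S , T′ , cover , _ , _ , _ , _ , _ , join , indS , indT) e f e∈B f∈B
    with edge-across indS indT cover e e∈B | edge-across indS indT cover f f∈B
  ... | s₁ , t₁ , s₁∈S , t₁∈T , s₁~e , t₁~e | s₂ , t₂ , s₂∈S , t₂∈T , s₂~f , t₂~f
    with inducedC4Free⇒completeBipartite-star c4 indS indT join s₁∈S s₂∈S t₁∈T t₂∈T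
  ... | inj₁ refl = incident⇒meets e f s₁~e s₂~f
  ... | inj₂ refl = incident⇒meets e f t₁~e t₂~f

  N[_] : Fin n → Subset n
  N[ c ] = tabulate (adj c)

  ∈N⁺ : Adj G c w → w ∈ N[ c ]
  ∈N⁺ {c} {w} cw = lookup⇒[]= w _ (trans (lookup∘tabulate (adj c) w) (Equivalence.to T-≡ cw))

  ∈N⁻ : w ∈ N[ c ] → Adj G c w
  ∈N⁻ {w} {c} w∈N =
    Equivalence.from T-≡ (trans (sym (lookup∘tabulate (adj c) w)) ([]=⇒lookup w∈N))

  star : Fin n → Subset n
  star c = ⁅ c ⁆ ∪ N[ c ]

  ∈star⁺ : w ≡ c ⊎ Adj G c w → w ∈ star c
  ∈star⁺ (inj₁ refl) = p⊆p∪q _ (x∈⁅x⁆ _)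
  ∈star⁺ (inj₂ cw)   = q⊆p∪q _ _ (∈N⁺ cw)

  incident⇒edgeIn-star : ∀ e → Incident c e → EdgeIn G e (star c)
  incident⇒edgeIn-star e (inj₁ refl) = ∈star⁺ (inj₁ refl) , ∈star⁺ (inj₂ (uv e))
  incident⇒edgeIn-star e (inj₂ refl) = ∈star⁺ (inj₂ (Adj-sym (uv e))) , ∈star⁺ (inj₁ refl)

  star-completeBipartite : TriangleFree G → Adj G c a → InducesCompleteBipartite G (star c)
  star-completeBipartite {c} {a} tf ca =
      ⁅ c ⁆ , N[ c ]
    , (λ w → x∈p∪q⁻ _ _)
    , (λ w → p⊆p∪q _) , (λ w → q⊆p∪q _ _)
    , (λ w w∈⁅c⁆ w∈N → Adj-irrefl (subst (Adj G c) (centre w∈⁅c⁆) (∈N⁻ w∈N)))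
    , (c , x∈⁅x⁆ c) , (a , ∈N⁺ ca)
    , (λ x y x∈⁅c⁆ y∈N → subst (λ z → Adj G z y) (sym (centre x∈⁅c⁆)) (∈N⁻ y∈N))
    , (λ x x′ x∈⁅c⁆ x′∈⁅c⁆ → Adj-irrefl ∘ subst₂ (Adj G) (centre x∈⁅c⁆) (centre x′∈⁅c⁆))
    , (λ y y′ y∈N y′∈N yy′ → tf c y y′ (∈N⁻ y∈N , yy′ , ∈N⁻ y′∈N))
    where
    centre : w ∈ ⁅ c ⁆ → w ≡ c
    centre = x∈⁅y⁆⇒x≡y c

  -- a and b are forced onto T′, after which S can contain no vertex but c.
  fork⇒within-star : InducedC4Free G → Adj G c a → Adj G c b → a ≢ b →
    Independent S → Independent T′ → FullyJoined S T′ → c ∈ S →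
    a ∈ S ⊎ a ∈ T′ → b ∈ S ⊎ b ∈ T′ → w ∈ S ⊎ w ∈ T′ → w ≡ c ⊎ Adj G c w
  fork⇒within-star c4 ca cb a≢b indS indT join c∈S (inj₁ a∈S) _ _ =
    ⊥-elim (indS _ _ c∈S a∈S ca)
  fork⇒within-star c4 ca cb a≢b indS indT join c∈S _ (inj₁ b∈S) _ =
    ⊥-elim (indS _ _ c∈S b∈S cb)
  fork⇒within-star c4 ca cb a≢b indS indT join c∈S (inj₂ a∈T) (inj₂ b∈T) (inj₂ w∈T) =
    inj₂ (join _ _ c∈S w∈T)
  fork⇒within-star c4 ca cb a≢b indS indT join c∈S (inj₂ a∈T) (inj₂ b∈T) (inj₁ w∈S)
    with inducedC4Free⇒completeBipartite-star c4 indS indT join c∈S w∈S a∈T b∈T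
  ... | inj₁ c≡w = inj₁ (sym c≡w)
  ... | inj₂ a≡b = ⊥-elim (a≢b a≡b)

  star-maximal : InducedC4Free G → Adj G c a → Adj G c b → a ≢ b →
    ∀ B′ → star c ⊆ B′ → InducesCompleteBipartite G B′ → B′ ⊆ star c
  star-maximal {c} {a} {b} c4 ca cb a≢b B′ star⊆B′
    (S , T′ , cover , _ , _ , _ , _ , _ , join , indS , indT) {w} w∈B′ =
    ∈star⁺ (centre-side (side c (∈star⁺ (inj₁ refl))))
    where
    side : ∀ z → z ∈ star c → z ∈ S ⊎ z ∈ T′
    side z = cover z ∘ star⊆B′

    a-side : a ∈ S ⊎ a ∈ T′
    a-side = side a (∈star⁺ (inj₂ ca))

    b-side : b ∈ S ⊎ b ∈ T′
    b-side = side b (∈star⁺ (inj₂ cb))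

    w-side : w ∈ S ⊎ w ∈ T′
    w-side = cover w w∈B′

    centre-side : c ∈ S ⊎ c ∈ T′ → w ≡ c ⊎ Adj G c w
    centre-side (inj₁ c∈S) =
      fork⇒within-star c4 ca cb a≢b indS indT join c∈S a-side b-side w-side
    centre-side (inj₂ c∈T) =
      fork⇒within-star c4 ca cb a≢b indT indS (FullyJoined-sym join) c∈T
        (swap a-side) (swap b-side) (swap w-side)

  star-isBiclique : TriangleFree G → InducedC4Free G →
    Adj G c a → Adj G c b → a ≢ b → IsBiclique G (star c)
  star-isBiclique tf c4 ca cb a≢b = star-completeBipartite tf ca , star-maximal c4 ca cb a≢b

  distinct-meeting-edges-fork : ∀ e f → ¬ SameEdge G e f → Meets e f →
    ∃[ c ] ∃[ a ] ∃[ b ] Adj G c a × Adj G c b × a ≢ b × Incident c e × Incident c f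
  distinct-meeting-edges-fork (edge c a ca) (edge _ b cb) e≢f (inj₁ refl) =
    c , a , b , ca , cb , (λ a≡b → e≢f (inj₁ (refl , a≡b))) , inj₁ refl , inj₁ refl
  distinct-meeting-edges-fork (edge c a ca) (edge b _ bc) e≢f (inj₂ (inj₁ refl)) =
    c , a , b , ca , Adj-sym bc , (λ a≡b → e≢f (inj₂ (refl , a≡b))) , inj₁ refl , inj₂ refl
  distinct-meeting-edges-fork (edge a c ac) (edge _ b cb) e≢f (inj₂ (inj₂ (inj₁ refl))) =
    c , a , b , Adj-sym ac , cb , (λ a≡b → e≢f (inj₂ (a≡b , refl))) , inj₂ refl , inj₁ refl
  distinct-meeting-edges-fork (edge a c ac) (edge b _ bc) e≢f (inj₂ (inj₂ (inj₂ refl))) =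
    c , a , b , Adj-sym ac , Adj-sym bc , (λ a≡b → e≢f (inj₁ (a≡b , refl))) , inj₂ refl , inj₂ refl

lemma13 : {n : ℕ} (G : Graph n) → TriangleFree G → InducedC4Free G →
    (e f : Edge G) → (BicliqueLineAdj G e f → LineAdj G e f) × (LineAdj G e f → BicliqueLineAdj G e f)
lemma13 G tf c4 e f = biclique⇒line , line⇒biclique
  where
  biclique⇒line : BicliqueLineAdj G e f → LineAdj G e f
  biclique⇒line (e≢f , B , (B-cb , _) , e∈B , f∈B) =
    e≢f , completeBipartite-edges-meet G c4 B-cb e f e∈B f∈B

  line⇒biclique : LineAdj G e f → BicliqueLineAdj G e f
  line⇒biclique (e≢f , e-meets-f) with distinct-meeting-edges-fork G e f e≢f e-meets-f
  ... | c , a , b , ca , cb , a≢b , c~e , c~f =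
    e≢f , star G c , star-isBiclique G tf c4 ca cb a≢b
        , incident⇒edgeIn-star G e c~e , incident⇒edgeIn-star G f c~f
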